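{- Let $(A,F,M)$ and $(B,G,N)$ be $\mathcal{P}$-models and $n\in\omega$. Then $(A,F,M)\rightarrow^n_p(B,G,N)$ if and only if for every classical $\mathcal{P}$-structure $C$ of tree-depth at most $n$, the existence of a classical homomorphism $C\to M^{\top}$ implies the existence of a classical homomorphism $C\to N^{\top}$.
   Context: An interpreting lattice is a pair $(A,F)$ where $A$ is an algebra in a signature $\mathcal{L}\supseteq\{\lor,\land\}$ such that $\langle A,\land,\lor\rangle$ is a lattice and $F\subseteq A$ satisfies: $a\land b\in F$ iff ($a\in F$ and $b\in F$), and $a\lor b\in F$ iff ($a\in F$ or $b\in F$). For a relational predicate language $\mathcal{P}$, a $\mathcal{P}$-model $(A,F,M)$ consists of an interpreting lattice, a nonempty set $M$ and maps $R^M:M^n\to A$ (with all infima/suprema needed to evaluate quantified formulas existing). A protomorphism from $(A,F,M)$ to $(B,G,N)$ is a map $g:M\to N$ with $R^M(\bar m)\in F\Rightarrow R^N(g(\bar m))\in G$ for all $R,\bar m$; written $\rightarrow_p$. The Gaifman graph of $(A,F,M)$ has vertex set $M$ and an edge between $m,m'$ iff there are $R\in\mathcal{P}$ and a tuple $\bar x$ from $M$ containing both $m$ and $m'$ with $R^M(\bar x)\in F$; the tree-depth of $(A,F,M)$ is the (standard graph-theoretic) tree-depth of its Gaifman graph. We write $(A,F,M)\rightarrow^n_p(B,G,N)$ iff for every $\mathcal{P}$-model $(C,H,S)$ of tree-depth at most $n$, $(C,H,S)\rightarrow_p(A,F,M)$ implies $(C,H,S)\rightarrow_p(B,G,N)$.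 $M^{\top}$ is the classical $\mathcal{P}$-structure with domain $M$ in which $R(\bar m)$ holds iff $R^M(\bar m)\in F$; classical structures, classical homomorphisms (maps preserving all relations) and their tree-depth (tree-depth of the classical Gaifman graph) are as usual. -}

module Defs where

open import Level using (Level; _⊔_) renaming (suc to lsuc; zero to lzero)
open import Data.Nat using (ℕ; zero; suc; _≤_; _≟_)
open import Data.Fin using (Fin)
open import Data.Maybe using (Maybe; just; nothing; _>>=_)
open import Data.Product using (Σ; ∃; _×_; _,_)
open import Data.Sum using (_⊎_)
open import Relation.Nullary using (yes; no)
open import Relation.Binary.PropositionalEquality using (_≡_)
open import Algebra.Lattice.Bundles using (Lattice)

-- The algebraic signature 𝓛 of the interpreting lattices: the lattice
-- operations ∧, ∨ plus any further operation symbols (with arities).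
record AlgSig : Set₁ where
  field
    Op   : Set
    opAr : Op → ℕ
open AlgSig public

record PredLang : Set₁ where
  field
    Sym : Set
    ar  : Sym → ℕ
open PredLang public

-- Tree-depth of a (possibly infinite) graph given by an edge relation.
-- tree-depth ≤ n  iff  there is a rooted forest on the vertex set of
-- height ≤ n (height counted in vertices) whose closure (ancestor /
-- descendant relation) contains every edge.

module _ {ℓ ℓ' : Level} (V : Set ℓ) (E : V → V → Set ℓ') where

  iterParent : (V → Maybe V) → ℕ → V → Maybe V
  iterParent p zero    v = just v
  iterParent p (suc k) v = iterParent p k v >>= p

  record EliminationForest (n : ℕ) : Set (ℓ ⊔ ℓ') where
    field
      parent     : V → Maybe V
      depth      : V → ℕ
      depth-root : ∀ v → parent v ≡ nothing → depth v ≡ 1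
      depth-step : ∀ v u → parent v ≡ just u → depth v ≡ suc (depth u)
      depth-≤    : ∀ v → depth v ≤ n
    Anc : V → V → Set ℓ
    Anc u v = ∃ λ k → iterParent parent k v ≡ just u
    field
      closure    : ∀ x y → E x y → Anc x y ⊎ Anc y x

  TreeDepth≤ : ℕ → Set (ℓ ⊔ ℓ')
  TreeDepth≤ n = EliminationForest n

record InterpLattice (L : AlgSig) (ℓ : Level) : Set (lsuc ℓ) where
  field
    lattice : Lattice ℓ ℓ
  open Lattice lattice public
  field
    ⟦_⟧ₒ    : (o : Op L) → (Fin (opAr L o) → Carrier) → Carrier
    ⟦⟧-cong : ∀ o (as bs : Fin (opAr L o) → Carrier) →
              (∀ i → as i ≈ bs i) → ⟦ o ⟧ₒ as ≈ ⟦ o ⟧ₒ bs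
    F       : Carrier → Set ℓ
    F-resp  : ∀ {a b} → a ≈ b → F a → F b
    F-∧⇒    : ∀ a b → F (a ∧ b) → F a × F b
    F-∧⇐    : ∀ a b → F a × F b → F (a ∧ b)
    F-∨⇒    : ∀ a b → F (a ∨ b) → F a ⊎ F b
    F-∨⇐    : ∀ a b → F a ⊎ F b → F (a ∨ b)

  _≤ₗ_ : Carrier → Carrier → Set ℓ
  a ≤ₗ b = a ≈ (a ∧ b)

-- A 𝓟-model without the existence requirement on infima/suprema.
record PreModel (L : AlgSig) (P : PredLang) (ℓ : Level) : Set (lsuc ℓ) where
  field
    alg  : InterpLattice L ℓ
  open InterpLattice alg public
  field
    Dom  : Set ℓ
    elt  : Dom
    rel  : (R : Sym P) → (Fin (ar P R) → Dom) → Carrier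

data Formula (L : AlgSig) (P : PredLang) : Set where
  atom : (R : Sym P) → (Fin (ar P R) → ℕ) → Formula L P
  _∧f_ : Formula L P → Formula L P → Formula L P
  _∨f_ : Formula L P → Formula L P → Formula L P
  opf  : (o : Op L) → (Fin (opAr L o) → Formula L P) → Formula L P
  allf : ℕ → Formula L P → Formula L P
  exf  : ℕ → Formula L P → Formula L P

module _ {L : AlgSig} {P : PredLang} {ℓ : Level} (𝔐 : PreModel L P ℓ) where
  open PreModel 𝔐

  update : (ℕ → Dom) → ℕ → Dom → (ℕ → Dom)
  update σ x m y with y ≟ x
  ... | yes _ = m
  ... | no  _ = σ y

  IsInf : (Dom → Carrier) → Carrier → Set ℓ
  IsInf f a = (∀ m → a ≤ₗ f m) × (∀ b → (∀ m → b ≤ₗ f m) → b ≤ₗ a)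

  IsSup : (Dom → Carrier) → Carrier → Set ℓ
  IsSup f a = (∀ m → f m ≤ₗ a) × (∀ b → (∀ m → f m ≤ₗ b) → a ≤ₗ b)

  -- Eval φ σ a : the value of φ under assignment σ is (defined and) a
  data Eval : Formula L P → (ℕ → Dom) → Carrier → Set ℓ where
    ev-atom : ∀ R ts σ → Eval (atom R ts) σ (rel R (λ i → σ (ts i)))
    ev-∧    : ∀ {φ ψ σ a b} → Eval φ σ a → Eval ψ σ b → Eval (φ ∧f ψ) σ (a ∧ b)
    ev-∨    : ∀ {φ ψ σ a b} → Eval φ σ a → Eval ψ σ b → Eval (φ ∨f ψ) σ (a ∨ b)
    ev-op   : ∀ {o φs σ} (as : Fin (opAr L o) → Carrier) →
              (∀ i → Eval (φs i) σ (as i)) → Eval (opf o φs) σ (⟦ o ⟧ₒ as)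
    ev-all  : ∀ {x φ σ a} (f : Dom → Carrier) →
              (∀ m → Eval φ (update σ x m) (f m)) → IsInf f a → Eval (allf x φ) σ a
    ev-ex   : ∀ {x φ σ a} (f : Dom → Carrier) →
              (∀ m → Eval φ (update σ x m) (f m)) → IsSup f a → Eval (exf x φ) σ a

  AllValuesExist : Set ℓ
  AllValuesExist = ∀ φ σ → ∃ λ a → Eval φ σ a

record Model (L : AlgSig) (P : PredLang) (ℓ : Level) : Set (lsuc ℓ) where
  field
    pre    : PreModel L P ℓ
    values : AllValuesExist pre
  open PreModel pre public

module _ {L : AlgSig} {P : PredLang} {ℓ : Level} where

  IsProtomorphism : (𝔄 𝔅 : Model L P ℓ) → (Model.Dom 𝔄 → Model.Dom 𝔅) → Set ℓ
  IsProtomorphism 𝔄 𝔅 g = ∀ (R : Sym P) (ms : Fin (ar P R) → Model.Dom 𝔄) →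
    Model.F 𝔄 (Model.rel 𝔄 R ms) → Model.F 𝔅 (Model.rel 𝔅 R (λ i → g (ms i)))

  _→ₚ_ : Model L P ℓ → Model L P ℓ → Set ℓ
  𝔄 →ₚ 𝔅 = Σ (Model.Dom 𝔄 → Model.Dom 𝔅) (IsProtomorphism 𝔄 𝔅)

  GaifmanEdge : (𝔄 : Model L P ℓ) → Model.Dom 𝔄 → Model.Dom 𝔄 → Set ℓ
  GaifmanEdge 𝔄 m m' = Σ (Sym P) λ R → Σ (Fin (ar P R) → Model.Dom 𝔄) λ xs →
    (∃ λ i → xs i ≡ m) × (∃ λ j → xs j ≡ m') × Model.F 𝔄 (Model.rel 𝔄 R xs)

  treeDepth≤ : Model L P ℓ → ℕ → Set ℓ
  treeDepth≤ 𝔄 n = TreeDepth≤ (Model.Dom 𝔄) (GaifmanEdge 𝔄) n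

  _→[_]ₚ_ : Model L P ℓ → ℕ → Model L P ℓ → Set (lsuc ℓ)
  𝔄 →[ n ]ₚ 𝔅 = ∀ (ℭ : Model L P ℓ) → treeDepth≤ ℭ n → ℭ →ₚ 𝔄 → ℭ →ₚ 𝔅

record Structure (P : PredLang) (ℓ : Level) : Set (lsuc ℓ) where
  field
    Dom : Set ℓ
    elt : Dom
    rel : (R : Sym P) → (Fin (ar P R) → Dom) → Set ℓ

module _ {P : PredLang} {ℓ : Level} where

  IsHom : (C D : Structure P ℓ) → (Structure.Dom C → Structure.Dom D) → Set ℓ
  IsHom C D h = ∀ (R : Sym P) (xs : Fin (ar P R) → Structure.Dom C) →
    Structure.rel C R xs → Structure.rel D R (λ i → h (xs i))

  _⇒_ : Structure P ℓ → Structure P ℓ → Set ℓ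
  C ⇒ D = Σ (Structure.Dom C → Structure.Dom D) (IsHom C D)

  ClGaifmanEdge : (C : Structure P ℓ) → Structure.Dom C → Structure.Dom C → Set ℓ
  ClGaifmanEdge C m m' = Σ (Sym P) λ R → Σ (Fin (ar P R) → Structure.Dom C) λ xs →
    (∃ λ i → xs i ≡ m) × (∃ λ j → xs j ≡ m') × Structure.rel C R xs

  clTreeDepth≤ : Structure P ℓ → ℕ → Set ℓ
  clTreeDepth≤ C n = TreeDepth≤ (Structure.Dom C) (ClGaifmanEdge C) n

_⊤ : {L : AlgSig} {P : PredLang} {ℓ : Level} → Model L P ℓ → Structure P ℓ
𝔄 ⊤ = record
  { Dom = Model.Dom 𝔄
  ; elt = Model.elt 𝔄
  ; rel = λ R ms → Model.F 𝔄 (Model.rel 𝔄 R ms)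
  }

{-# OPTIONS --safe #-}
module Submission where

open import Defs
open import Level using (Level)
open import Data.Nat using (ℕ)
open import Data.Product using (_×_; _,_; proj₁; proj₂; Σ; uncurry; <_,_>)
import Data.Product as Product
open import Data.Product.Function.NonDependent.Propositional using (_×-⇔_)
open import Data.Sum using (_⊎_; inj₁; [_,_]′)
import Data.Sum as Sum
open import Data.Sum.Function.Propositional using (_⊎-⇔_)
open import Data.Unit.Polymorphic using () renaming (⊤ to Unit)
open import Function using (id)
open import Function.Bundles using (_⇔_; mk⇔; Equivalence)
open import Function.Properties.Equivalence using (⇔-isEquivalence)
open import Algebra.Lattice.Bundles using (Lattice)
open import Algebra.Lattice.Structures using (IsLattice)
import Relation.Binary.Construct.On as On

-- A protomorphism ℭ → 𝔄 is literally a homomorphism ℭ ⊤ → 𝔄 ⊤, and ℭ and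
-- ℭ ⊤ have the same Gaifman graph; so the classical condition, applied to
-- ℭ ⊤, gives 𝔄 →ⁿₚ 𝔅.  Conversely, every classical structure C is of the
-- form ℭ ⊤: interpret the relations of C in the lattice of propositions
-- generated by the atomic facts of C under ∧, ∨ and quantification over
-- the domain, with F the true propositions.  Quantifiers are built in, so
-- every formula has a value, and the hypothesis 𝔄 →ⁿₚ 𝔅 applies to ℭ.

module PropositionLattice {ℓ : Level} (D : Set ℓ) {Atom : Set ℓ} (Holds : Atom → Set ℓ) where

  infixr 7 _∧ᵖ_
  infixr 6 _∨ᵖ_
  infix 4 _≈ᵖ_ _≤ᵖ_

  data Prop : Set ℓ where
    ⊤ᵖ        : Prop
    atomᵖ     : Atom → Prop
    _∧ᵖ_ _∨ᵖ_ : Prop → Prop → Prop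
    ∀ᵖ ∃ᵖ     : (D → Prop) → Prop

  ⟦_⟧ : Prop → Set ℓ
  ⟦ ⊤ᵖ ⟧      = Unit
  ⟦ atomᵖ a ⟧ = Holds a
  ⟦ p ∧ᵖ q ⟧  = ⟦ p ⟧ × ⟦ q ⟧
  ⟦ p ∨ᵖ q ⟧  = ⟦ p ⟧ ⊎ ⟦ q ⟧
  ⟦ ∀ᵖ f ⟧    = ∀ d → ⟦ f d ⟧
  ⟦ ∃ᵖ f ⟧    = Σ D λ d → ⟦ f d ⟧

  _≈ᵖ_ : Prop → Prop → Set ℓ
  p ≈ᵖ q = ⟦ p ⟧ ⇔ ⟦ q ⟧

  _≤ᵖ_ : Prop → Prop → Set ℓ
  p ≤ᵖ q = p ≈ᵖ p ∧ᵖ q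

  -- p and q are explicit: ⟦_⟧ is not injective, so they cannot be inferred.
  entails⇒≤ᵖ : ∀ p q → (⟦ p ⟧ → ⟦ q ⟧) → p ≤ᵖ q
  entails⇒≤ᵖ _ _ p⇒q = mk⇔ < id , p⇒q > proj₁

  ≤ᵖ⇒entails : ∀ p q → p ≤ᵖ q → ⟦ p ⟧ → ⟦ q ⟧
  ≤ᵖ⇒entails _ _ p≤q x = proj₂ (Equivalence.to p≤q x)

  isLattice : IsLattice _≈ᵖ_ _∨ᵖ_ _∧ᵖ_
  isLattice = record
    { isEquivalence = On.isEquivalence ⟦_⟧ ⇔-isEquivalence
    ; ∨-comm        = λ _ _ → mk⇔ Sum.swap Sum.swap
    ; ∨-assoc       = λ _ _ _ → mk⇔ Sum.assocʳ Sum.assocˡ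
    ; ∨-cong        = _⊎-⇔_
    ; ∧-comm        = λ _ _ → mk⇔ Product.swap Product.swap
    ; ∧-assoc       = λ _ _ _ → mk⇔ Product.assocʳ′ Product.assocˡ′
    ; ∧-cong        = _×-⇔_
    ; absorptive    = (λ _ _ → mk⇔ [ id , proj₁ ]′ inj₁)
                    , (λ _ _ → mk⇔ proj₁ < id , inj₁ >)
    }

  lattice : Lattice ℓ ℓ
  lattice = record { isLattice = isLattice }

  interpLattice : (L : AlgSig) → InterpLattice L ℓ
  interpLattice L = record
    { lattice = lattice
    ; ⟦_⟧ₒ    = λ _ _ → ⊤ᵖ
    ; ⟦⟧-cong = λ _ _ _ _ → mk⇔ id id
    ; F       = ⟦_⟧
    ; F-resp  = Equivalence.to
    ; F-∧⇒    = λ _ _ → id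
    ; F-∧⇐    = λ _ _ → id
    ; F-∨⇒    = λ _ _ → id
    ; F-∨⇐    = λ _ _ → id
    }

module Realisation {L : AlgSig} {P : PredLang} {ℓ : Level} (C : Structure P ℓ) where
  open Structure C
  open PropositionLattice Dom (uncurry rel)

  realisePre : PreModel L P ℓ
  realisePre = record
    { alg = interpLattice L
    ; Dom = Dom
    ; elt = elt
    ; rel = λ R xs → atomᵖ (R , xs)
    }

  ∀ᵖ-isInf : ∀ f → IsInf realisePre f (∀ᵖ f)
  ∀ᵖ-isInf f = (λ d → entails⇒≤ᵖ (∀ᵖ f) (f d) (λ x → x d))
             , (λ q q≤f → entails⇒≤ᵖ q (∀ᵖ f) (λ x d → ≤ᵖ⇒entails q (f d) (q≤f d) x))

  ∃ᵖ-isSup : ∀ f → IsSup realisePre f (∃ᵖ f)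
  ∃ᵖ-isSup f = (λ d → entails⇒≤ᵖ (f d) (∃ᵖ f) (d ,_))
             , (λ q f≤q → entails⇒≤ᵖ (∃ᵖ f) q (λ (d , x) → ≤ᵖ⇒entails (f d) q (f≤q d) x))

  value : Formula L P → (ℕ → Dom) → Prop
  value (atom R ts) σ = atomᵖ (R , λ i → σ (ts i))
  value (φ ∧f ψ)    σ = value φ σ ∧ᵖ value ψ σ
  value (φ ∨f ψ)    σ = value φ σ ∨ᵖ value ψ σ
  value (opf o φs)  σ = ⊤ᵖ
  value (allf x φ)  σ = ∀ᵖ λ d → value φ (update realisePre σ x d)
  value (exf x φ)   σ = ∃ᵖ λ d → value φ (update realisePre σ x d)

  eval-value : ∀ φ σ → Eval realisePre φ σ (value φ σ)
  eval-value (atom R ts) σ = ev-atom R ts σ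
  eval-value (φ ∧f ψ)    σ = ev-∧ (eval-value φ σ) (eval-value ψ σ)
  eval-value (φ ∨f ψ)    σ = ev-∨ (eval-value φ σ) (eval-value ψ σ)
  eval-value (opf o φs)  σ = ev-op _ (λ i → eval-value (φs i) σ)
  eval-value (allf x φ)  σ = ev-all _ (λ d → eval-value φ (update realisePre σ x d))
                                      (∀ᵖ-isInf λ d → value φ (update realisePre σ x d))
  eval-value (exf x φ)   σ = ev-ex _ (λ d → eval-value φ (update realisePre σ x d))
                                     (∃ᵖ-isSup λ d → value φ (update realisePre σ x d))

  realise : Model L P ℓ
  realise = record { pre = realisePre ; values = λ φ σ → value φ σ , eval-value φ σ }

open Realisation using (realise)

-- Both directions only re-read a hypothesis: realise C ⊤ is C, ℭ →ₚ 𝔄 is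
-- ℭ ⊤ ⇒ 𝔄 ⊤ and treeDepth≤ ℭ n is clTreeDepth≤ (ℭ ⊤) n, definitionally.
mainTheorem9 : {L : AlgSig} {P : PredLang} {ℓ : Level} (𝔄 𝔅 : Model L P ℓ) (n : ℕ) →
    ((𝔄 →[ n ]ₚ 𝔅) → (∀ (C : Structure P ℓ) → clTreeDepth≤ C n → C ⇒ (𝔄 ⊤) → C ⇒ (𝔅 ⊤)))
    × ((∀ (C : Structure P ℓ) → clTreeDepth≤ C n → C ⇒ (𝔄 ⊤) → C ⇒ (𝔅 ⊤)) → (𝔄 →[ n ]ₚ 𝔅))
mainTheorem9 𝔄 𝔅 n =
    (λ 𝔄→ⁿ𝔅 C C-depth C⇒𝔄⊤ → 𝔄→ⁿ𝔅 (realise C) C-depth C⇒𝔄⊤)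
  , (λ classical ℭ ℭ-depth ℭ→𝔄 → classical (ℭ ⊤) ℭ-depth ℭ→𝔄)
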